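{- Let $t \geq 1$ be an integer and let $q$ be a prime power such that $t$ divides $q-1$. Let $\theta$ be a generator of the multiplicative group $\mathbb{F}_{q^2}^* = \mathbb{F}_{q^2}\setminus\{0\}$, let \[ A = \{a \in \mathbb{Z}_{q^2-1} : \theta^a - \theta \in \mathbb{F}_q\}, \] and let $H$ be the subgroup of $\mathbb{Z}_{q^2-1}$ generated by $\left(\frac{q-1}{t}\right)(q+1)$. Let $\Gamma_{q,t}$ be the 3-partite graph with parts $X$, $Y$, $Z$, each a disjoint copy of the quotient group $\mathbb{Z}_{q^2-1}/H$, with the following edges (and no others): for every $a \in A$, a vertex $x+H \in X$ is adjacent to $x+a+H \in Y$; a vertex $y+H \in Y$ is adjacent to $y+a+H \in Z$; and a vertex $z+H \in Z$ is adjacent to $z+a+H \in X$. Then $\Gamma_{q,t}$ contains no subgraph isomorphic to $K_{2,2t+1}$.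
   Context: $\mathbb{F}_q$ denotes the finite field with $q$ elements, viewed as a subfield of $\mathbb{F}_{q^2}$; $\mathbb{Z}_{q^2-1}$ is the additive cyclic group of integers modulo $q^2-1$. $K_{2,2t+1}$ is the complete bipartite graph with parts of sizes $2$ and $2t+1$. -}

module Defs where

open import Level using (0ℓ)
open import Algebra.Bundles using (CommutativeRing)
open import Data.Nat using (ℕ; zero; suc; _^_; _<_; _≥_; NonZero)
import Data.Nat as ℕ
open import Data.Nat.DivMod using (_%_; _/_)
open import Data.Nat.Primality using (Prime)
open import Data.Fin using (Fin)
open import Data.Product using (Σ; ∃; _×_; _,_)
open import Data.Sum using (_⊎_)
open import Relation.Nullary using (¬_)
open import Relation.Binary.PropositionalEquality using (_≡_)

IsPrimePower : ℕ → Set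
IsPrimePower q = Σ ℕ λ p → Σ ℕ λ k → Prime p × k ≥ 1 × q ≡ p ^ k

module _ (R : CommutativeRing 0ℓ 0ℓ) where
  open CommutativeRing R

  pow : Carrier → ℕ → Carrier
  pow x zero    = 1#
  pow x (suc n) = x * pow x n

  record IsFiniteFieldOfSize (n : ℕ) : Set where
    field
      nontrivial : ¬ (1# ≈ 0#)
      inverse    : ∀ x → ¬ (x ≈ 0#) → Σ Carrier λ y → x * y ≈ 1#
      enum       : Fin n → Carrier
      enum-inj   : ∀ i j → enum i ≈ enum j → i ≡ j
      enum-surj  : ∀ x → Σ (Fin n) λ i → enum i ≈ x

  -- S is a subfield of R with exactly m elements (the copy of 𝔽_q inside 𝔽_{q²})
  record IsSubfieldOfSize (S : Carrier → Set) (m : ℕ) : Set where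
    field
      resp      : ∀ {x y} → x ≈ y → S x → S y
      has-0     : S 0#
      has-1     : S 1#
      closed-+  : ∀ {x y} → S x → S y → S (x + y)
      closed-neg : ∀ {x} → S x → S (- x)
      closed-*  : ∀ {x y} → S x → S y → S (x * y)
      closed-inv : ∀ {x y} → S x → x * y ≈ 1# → S y
      enum      : Fin m → Carrier
      enum-in   : ∀ i → S (enum i)
      enum-inj  : ∀ i j → enum i ≈ enum j → i ≡ j
      enum-surj : ∀ x → S x → Σ (Fin m) λ i → enum i ≈ x

  IsGenerator : Carrier → Set
  IsGenerator θ = ¬ (θ ≈ 0#) × (∀ x → ¬ (x ≈ 0#) → Σ ℕ λ a → x ≈ pow θ a)

  -- A = { a ∈ ℤ_{q²-1} : θ^a - θ ∈ 𝔽_q }, elements of ℤ_{q²-1} represented by 0 ≤ a < q²-1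
  InA : (S : Carrier → Set) (q : ℕ) (θ : Carrier) → ℕ → Set
  InA S q θ a = a < q ^ 2 ℕ.∸ 1 × S (pow θ a - θ)

-- The graph Γ_{q,t}.  Elements of ℤ_{n}, n = q²-1, are represented by naturals
-- (taken mod n); H = ⟨g⟩ with g = ((q-1)/t)(q+1).
open import Data.Nat using (_+_; _*_; _∸_)

module Gamma (q t : ℕ) .{{_ : NonZero t}} .{{_ : NonZero (q ^ 2 ∸ 1)}} (InA' : ℕ → Set) where

  n : ℕ
  n = q ^ 2 ∸ 1

  g : ℕ
  g = ((q ∸ 1) / t) * (q + 1)

  -- x + H = y + H in ℤ_n / H  (H = { k·g mod n : k ∈ ℕ })
  _∼H_ : ℕ → ℕ → Set
  x ∼H y = Σ ℕ λ k → (x + k * g) % n ≡ y % n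

  -- vertices: part (0 = X, 1 = Y, 2 = Z) together with a representative of a coset
  Vertex : Set
  Vertex = Fin 3 × ℕ

  _≋_ : Vertex → Vertex → Set
  (i , x) ≋ (j , y) = i ≡ j × x ∼H y

  next : Fin 3 → Fin 3
  next Fin.zero = Fin.suc Fin.zero
  next (Fin.suc Fin.zero) = Fin.suc (Fin.suc Fin.zero)
  next (Fin.suc (Fin.suc Fin.zero)) = Fin.zero

  -- directed description of the edges: X→Y, Y→Z, Z→X, v+H ~ v+a+H for a ∈ A
  Arc : Vertex → Vertex → Set
  Arc (i , x) (j , y) = j ≡ next i × Σ ℕ λ a → InA' a × (x + a) ∼H y

  Adj : Vertex → Vertex → Set
  Adj u v = Arc u v ⊎ Arc v u

  ContainsK2 : ℕ → Set
  ContainsK2 m =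
    Σ Vertex λ u₁ → Σ Vertex λ u₂ → Σ (Fin m → Vertex) λ w →
      ¬ (u₁ ≋ u₂) ×
      (∀ i → ¬ (u₁ ≋ w i) × ¬ (u₂ ≋ w i)) ×
      (∀ i j → w i ≋ w j → i ≡ j) ×
      (∀ i → Adj u₁ (w i) × Adj u₂ (w i))

module Submission where

-- Let n = q² − 1. The exponents a with θ^a − θ ∈ 𝔽_q form a Sidon set modulo n: if
-- a + b ≡ c + d then (θ + α)(θ + β) = (θ + γ)(θ + δ) for α = θ^a − θ, … in 𝔽_q, and as
-- θ ∉ 𝔽_q, comparing the coefficients of θ gives α + β = γ + δ and αβ = γδ, whence
-- {α, β} = {γ, δ}. Since t·g = n for the generator g of H, every relation x + H = y + H is
-- witnessed by y − x = k·g with 0 ≤ k < t. Two distinct vertices u₁ = x + H, u₂ = y + H lie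
-- in the same part or in consecutive parts. In the first case a common neighbour v is reached
-- from both by arcs a, b of the same direction, and the direction together with the k relating
-- x + a and y + b determines v, by the Sidon property. In the second case the path
-- u₂ → v → u₁ has labels b, a, and k together with whether b ≤ a determines v. Either way
-- there are at most 2t common neighbours.

open import Defs
open import Level using (0ℓ)
open import Algebra.Bundles using (CommutativeRing)
import Algebra.Properties.CommutativeSemigroup as CommutativeSemigroupProperties
open import Data.Bool using (Bool; true; false; T)
open import Data.Empty using (⊥-elim)
open import Data.Fin using (Fin; toℕ; fromℕ<; punchOut)
import Data.Fin as Fin
open import Data.Fin.Patterns using (0F; 1F; 2F)
import Data.Fin.Properties as Fin
open import Data.Maybe using (nothing)
import Data.Nat as ℕ
open import Data.Nat using (ℕ; zero; suc; _∸_; _^_; _<_; _≤_; _≥_; _≤ᵇ_; NonZero; z≤n; s≤s)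
import Data.Nat.Properties as ℕ
open import Data.Nat.Divisibility using (_∣_)
open import Data.Nat.DivMod
  using (_%_; _/_; %-distribˡ-+; [m+kn]%n≡m%n; [m+n]%n≡m%n; m%n%n≡m%n; m%n<n; m≡m%n+[m/n]*n; m*[n/m]≡n)
open import Data.Nat.Tactic.RingSolver using (solve-∀)
open import Data.Product using (∃; _×_; _,_; proj₁; proj₂; uncurry)
open import Data.Product.Function.NonDependent.Propositional using (_×-↔_)
open import Data.Sum using (_⊎_; inj₁; inj₂)
open import Function using (_on_)
open import Function.Bundles using (_↣_; Injection)
open import Function.Properties.Inverse using (↔-refl; ↔-sym; ↔-trans; ↔⇒↣)
open import Relation.Binary.Bundles using (Setoid)
import Relation.Binary.Construct.On as On
open import Relation.Binary.Definitions using (Decidable; tri<; tri≈; tri>)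
open import Relation.Binary.PropositionalEquality as ≡ using (_≡_; _≢_)
open import Relation.Nullary using (¬_; yes; no; contradiction)
open import Relation.Nullary.Decidable using (map′)
import Tactic.RingSolver as RingSolver
open import Tactic.RingSolver.Core.AlmostCommutativeRing using (AlmostCommutativeRing; fromCommutativeRing)

-- Sidon sets modulo n

≤ᵇ-flip⇒≡ : ∀ {m n} → (m ≤ᵇ n) ≡ (n ≤ᵇ m) → m ≡ n
≤ᵇ-flip⇒≡ {m} {n} eq with ℕ.≤-total m n
... | inj₁ m≤n = ℕ.≤-antisym m≤n (ℕ.≤ᵇ⇒≤ n m (≡.subst T eq (ℕ.≤⇒≤ᵇ m≤n)))
... | inj₂ n≤m = ℕ.≤-antisym (ℕ.≤ᵇ⇒≤ m n (≡.subst T (≡.sym eq) (ℕ.≤⇒≤ᵇ n≤m))) n≤m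

module Modulo (n : ℕ) .{{_ : NonZero n}} where
  open import Data.Nat using (_+_; _*_)
  open ≡ using (refl; sym; trans; cong; cong₂)
  open CommutativeSemigroupProperties ℕ.+-commutativeSemigroup using (xy∙z≈xz∙y)

  infix 4 _≡ₘ_
  _≡ₘ_ : ℕ → ℕ → Set
  _≡ₘ_ = _≡_ on (_% n)

  ≡ₘ-setoid : Setoid _ _
  ≡ₘ-setoid = On.setoid {B = ℕ} (≡.setoid ℕ) (_% n)

  +-cong-≡ₘ : ∀ {x x′ y y′} → x ≡ₘ x′ → y ≡ₘ y′ → x + y ≡ₘ x′ + y′
  +-cong-≡ₘ {x} {x′} {y} {y′} x≡x′ y≡y′ = begin
    (x + y) % n               ≡⟨ %-distribˡ-+ x y n ⟩
    (x % n + y % n) % n       ≡⟨ cong₂ (λ a b → (a + b) % n) x≡x′ y≡y′ ⟩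
    (x′ % n + y′ % n) % n     ≡⟨ %-distribˡ-+ x′ y′ n ⟨
    (x′ + y′) % n             ∎
    where open ≡.≡-Reasoning

  +-multiple-≡ₘ : ∀ x k → x + k * n ≡ₘ x
  +-multiple-≡ₘ x k = [m+kn]%n≡m%n x k n

  +-inverse-≡ₘ : ∀ x z → x + (z + (n ∸ z % n)) ≡ₘ x
  +-inverse-≡ₘ x z = begin
    x + (z + (n ∸ z % n))        ≈⟨ +-cong-≡ₘ {x} refl (+-cong-≡ₘ {z} (sym (m%n%n≡m%n z n)) refl) ⟩
    x + (z % n + (n ∸ z % n))    ≡⟨ cong (x +_) (ℕ.m+[n∸m]≡n (ℕ.<⇒≤ (m%n<n z n))) ⟩
    x + n                        ≈⟨ [m+n]%n≡m%n x n ⟩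
    x                            ∎
    where open import Relation.Binary.Reasoning.Setoid ≡ₘ-setoid

  +-cancelʳ-≡ₘ : ∀ x y z → x + z ≡ₘ y + z → x ≡ₘ y
  +-cancelʳ-≡ₘ x y z eq = begin
    x                   ≈⟨ +-inverse-≡ₘ x z ⟨
    x + (z + z⁻)        ≡⟨ ℕ.+-assoc x z z⁻ ⟨
    (x + z) + z⁻        ≈⟨ +-cong-≡ₘ {x + z} {y + z} {z⁻} eq refl ⟩
    (y + z) + z⁻        ≡⟨ ℕ.+-assoc y z z⁻ ⟩
    y + (z + z⁻)        ≈⟨ +-inverse-≡ₘ y z ⟩
    y                   ∎
    where
    open import Relation.Binary.Reasoning.Setoid ≡ₘ-setoid
    z⁻ = n ∸ z % n

  IsSidon : (ℕ → Set) → Set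
  IsSidon A = ∀ {a b c d} → A a → A b → A c → A d →
              a + b ≡ₘ c + d → (a ≡ c × b ≡ d) ⊎ (a ≡ d × b ≡ c)

  module _ {A : ℕ → Set} (sidon : IsSidon A) where

    sidon-difference : ∀ X Y c {a b a′ b′} → A a → A b → A a′ → A b′ →
                       X + a + c ≡ₘ Y + b → X + a′ + c ≡ₘ Y + b′ → a ≡ a′ ⊎ X + c ≡ₘ Y
    sidon-difference X Y c {a} {b} {a′} {b′} Aa Ab Aa′ Ab′ eq eq′
      with sidon Aa Ab′ Aa′ Ab (+-cancelʳ-≡ₘ (a + b′) (a′ + b) (X + c) cross)
      where
      open import Relation.Binary.Reasoning.Setoid ≡ₘ-setoid
      regroup : ∀ a b X c → (a + b) + (X + c) ≡ (X + a + c) + b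
      regroup = solve-∀
      cross : (a + b′) + (X + c) ≡ₘ (a′ + b) + (X + c)
      cross = begin
        (a + b′) + (X + c)     ≡⟨ regroup a b′ X c ⟩
        (X + a + c) + b′       ≈⟨ +-cong-≡ₘ {X + a + c} eq refl ⟩
        (Y + b) + b′           ≡⟨ xy∙z≈xz∙y Y b b′ ⟩
        (Y + b′) + b           ≈⟨ +-cong-≡ₘ {Y + b′} (sym eq′) refl ⟩
        (X + a′ + c) + b       ≡⟨ regroup a′ b X c ⟨
        (a′ + b) + (X + c)     ∎
    ... | inj₁ (a≡a′ , _) = inj₁ a≡a′
    ... | inj₂ (refl , _) = inj₂ (+-cancelʳ-≡ₘ (X + c) Y a (trans (cong (_% n) (xy∙z≈xz∙y X c a)) eq))

    sidon-ordered-sum : ∀ {a b a′ b′} → A a → A b → A a′ → A b′ →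
                        a + b ≡ₘ a′ + b′ → (a ≤ᵇ b) ≡ (a′ ≤ᵇ b′) → a ≡ a′
    sidon-ordered-sum Aa Ab Aa′ Ab′ eq ord with sidon Aa Ab Aa′ Ab′ eq
    ... | inj₁ (a≡a′ , _)    = a≡a′
    ... | inj₂ (refl , refl) = ≤ᵇ-flip⇒≡ ord

-- Finite fields and their generators

-- Without a zero test on coefficients the ring solver cannot cancel terms, so the identities
-- it proves here are free of subtraction; the arguments below are arranged accordingly.
module SemiringIdentities (R : CommutativeRing 0ℓ 0ℓ) where
  R′ : AlmostCommutativeRing 0ℓ 0ℓ
  R′ = fromCommutativeRing R (λ _ → nothing)
  open AlmostCommutativeRing R′

  linear-factors-expansion : ∀ θ α β → (θ + α) * (θ + β) ≈ θ * θ + (θ * (α + β) + α * β)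
  linear-factors-expansion = RingSolver.solve-∀ R′

  square-shift : ∀ α β d → (α + d) * (α + d) + α * β ≈ (α * α + α * β + α * d) + d * (α + d)
  square-shift = RingSolver.solve-∀ R′

  product-shift : ∀ α β d → (α + β) * (α + d) ≈ (α * α + α * β + α * d) + d * β
  product-shift = RingSolver.solve-∀ R′

  root-of-own-factors : ∀ γ δ → γ * γ + γ * δ ≈ (γ + δ) * γ
  root-of-own-factors = RingSolver.solve-∀ R′

module Powers (R : CommutativeRing 0ℓ 0ℓ) where
  open CommutativeRing R
  open import Relation.Binary.Reasoning.Setoid setoid

  pow-+ : ∀ x a b → pow R x (a ℕ.+ b) ≈ pow R x a * pow R x b
  pow-+ x zero    b = sym (*-identityˡ _)
  pow-+ x (suc a) b = trans (*-congˡ (pow-+ x a b)) (sym (*-assoc x _ _))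

  pow-multiple≈1 : ∀ {x d} → pow R x d ≈ 1# → ∀ k → pow R x (k ℕ.* d) ≈ 1#
  pow-multiple≈1 x^d≈1 zero    = refl
  pow-multiple≈1 {x} {d} x^d≈1 (suc k) = begin
    pow R x (d ℕ.+ k ℕ.* d)          ≈⟨ pow-+ x d (k ℕ.* d) ⟩
    pow R x d * pow R x (k ℕ.* d)    ≈⟨ *-cong x^d≈1 (pow-multiple≈1 x^d≈1 k) ⟩
    1# * 1#                          ≈⟨ *-identityˡ 1# ⟩
    1#                               ∎

  pow-% : ∀ {x d} .{{_ : NonZero d}} → pow R x d ≈ 1# → ∀ a → pow R x a ≈ pow R x (a % d)
  pow-% {x} {d} x^d≈1 a = begin
    pow R x a                               ≡⟨ ≡.cong (pow R x) (m≡m%n+[m/n]*n a d) ⟩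
    pow R x (a % d ℕ.+ a / d ℕ.* d)         ≈⟨ pow-+ x (a % d) (a / d ℕ.* d) ⟩
    pow R x (a % d) * pow R x (a / d ℕ.* d) ≈⟨ *-congˡ (pow-multiple≈1 x^d≈1 (a / d)) ⟩
    pow R x (a % d) * 1#                    ≈⟨ *-identityʳ _ ⟩
    pow R x (a % d)                         ∎

module FiniteField {N : ℕ} (F : CommutativeRing 0ℓ 0ℓ) (fin : IsFiniteFieldOfSize F N) where
  open CommutativeRing F
  open IsFiniteFieldOfSize fin
  open import Algebra.Properties.Ring ring using (+-cancelˡ; +-cancelʳ; x∙y⁻¹≈ε⇒x≈y; //-rightDividesˡ)
  open CommutativeSemigroupProperties +-commutativeSemigroup using (x∙yz≈y∙xz)
  open SemiringIdentities F
  open import Relation.Binary.Reasoning.Setoid setoid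

  index : Carrier → Fin N
  index x = proj₁ (enum-surj x)

  index-injective : ∀ {x y} → index x ≡ index y → x ≈ y
  index-injective {x} {y} eq =
    trans (sym (proj₂ (enum-surj x))) (trans (reflexive (≡.cong enum eq)) (proj₂ (enum-surj y)))

  _≟_ : Decidable _≈_
  x ≟ y = map′ index-injective
    (λ x≈y → enum-inj _ _ (trans (proj₂ (enum-surj x)) (trans x≈y (sym (proj₂ (enum-surj y))))))
    (index x Fin.≟ index y)

  *-cancelˡ-nonzero : ∀ {x y z} → ¬ x ≈ 0# → x * y ≈ x * z → y ≈ z
  *-cancelˡ-nonzero {x} {y} {z} x≉0 xy≈xz with inverse x x≉0
  ... | x⁻¹ , xx⁻¹≈1 = begin
    y                ≈⟨ *-identityˡ y ⟨
    1# * y           ≈⟨ *-congʳ x⁻¹x≈1 ⟨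
    (x⁻¹ * x) * y    ≈⟨ *-assoc x⁻¹ x y ⟩
    x⁻¹ * (x * y)    ≈⟨ *-congˡ xy≈xz ⟩
    x⁻¹ * (x * z)    ≈⟨ *-assoc x⁻¹ x z ⟨
    (x⁻¹ * x) * z    ≈⟨ *-congʳ x⁻¹x≈1 ⟩
    1# * z           ≈⟨ *-identityˡ z ⟩
    z                ∎
    where
    x⁻¹x≈1 : x⁻¹ * x ≈ 1#
    x⁻¹x≈1 = trans (*-comm x⁻¹ x) xx⁻¹≈1

  nonzero-* : ∀ {x y} → ¬ x ≈ 0# → ¬ y ≈ 0# → ¬ x * y ≈ 0#
  nonzero-* {x} x≉0 y≉0 xy≈0 = y≉0 (*-cancelˡ-nonzero x≉0 (trans xy≈0 (sym (zeroʳ x))))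

  quadratic-root : ∀ α β x → x * x + α * β ≈ (α + β) * x → x ≈ α ⊎ x ≈ β
  quadratic-root α β x root with x ≟ α
  ... | yes x≈α = inj₁ x≈α
  ... | no  x≉α = inj₂ (*-cancelˡ-nonzero (λ d≈0 → x≉α (x∙y⁻¹≈ε⇒x≈y x α d≈0))
                          (+-cancelˡ C (d * x) (d * β) shifted))
    where
    d = x - α
    C = α * α + α * β + α * d
    α+d≈x : α + d ≈ x
    α+d≈x = trans (+-comm α d) (//-rightDividesˡ α x)
    shifted : C + d * x ≈ C + d * β
    shifted = begin
      C + d * x                       ≈⟨ +-congˡ (*-congˡ α+d≈x) ⟨
      C + d * (α + d)                 ≈⟨ square-shift α β d ⟨
      (α + d) * (α + d) + α * β       ≈⟨ +-congʳ (*-cong α+d≈x α+d≈x) ⟩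
      x * x + α * β                   ≈⟨ root ⟩
      (α + β) * x                     ≈⟨ *-congˡ α+d≈x ⟨
      (α + β) * (α + d)               ≈⟨ product-shift α β d ⟩
      C + d * β                       ∎

  symmetric⇒pair : ∀ {α β γ δ} → α + β ≈ γ + δ → α * β ≈ γ * δ →
                   (α ≈ γ × β ≈ δ) ⊎ (α ≈ δ × β ≈ γ)
  symmetric⇒pair {α} {β} {γ} {δ} sums products with quadratic-root α β γ γ-root
    where
    γ-root : γ * γ + α * β ≈ (α + β) * γ
    γ-root = begin
      γ * γ + α * β      ≈⟨ +-congˡ products ⟩
      γ * γ + γ * δ      ≈⟨ root-of-own-factors γ δ ⟩
      (γ + δ) * γ        ≈⟨ *-congʳ sums ⟨
      (α + β) * γ        ∎
  ... | inj₁ γ≈α = inj₁ (sym γ≈α , +-cancelˡ α β δ (trans sums (+-congʳ γ≈α)))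
  ... | inj₂ γ≈β = inj₂ (+-cancelʳ β α δ (trans sums (trans (+-congʳ γ≈β) (+-comm β δ))) , sym γ≈β)

  module _ {K : Carrier → Set} {m} (sub : IsSubfieldOfSize F K m) where
    private module K = IsSubfieldOfSize sub

    K-solution : ∀ {x d e} → K d → K e → ¬ d ≈ 0# → x * d ≈ e → K x
    K-solution {x} {d} {e} Kd Ke d≉0 xd≈e with inverse d d≉0
    ... | d⁻¹ , dd⁻¹≈1 = K.resp (sym x≈) (K.closed-* Ke (K.closed-inv Kd dd⁻¹≈1))
      where
      x≈ : x ≈ e * d⁻¹
      x≈ = begin
        x                 ≈⟨ *-identityʳ x ⟨
        x * 1#            ≈⟨ *-congˡ dd⁻¹≈1 ⟨
        x * (d * d⁻¹)     ≈⟨ *-assoc x d d⁻¹ ⟨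
        (x * d) * d⁻¹     ≈⟨ *-congʳ xd≈e ⟩
        e * d⁻¹           ∎

    module _ {θ} (θ∉K : ¬ K θ) where

      K-linear-independence : ∀ {a b a′ b′} → K a → K b → K a′ → K b′ →
                              θ * a + b ≈ θ * a′ + b′ → a ≈ a′
      K-linear-independence {a} {b} {a′} {b′} Ka Kb Ka′ Kb′ eq with a ≟ a′
      ... | yes a≈a′ = a≈a′
      ... | no  a≉a′ = contradiction (K-solution Kd Ke d≉0 θd≈e) θ∉K
        where
        d = a - a′
        e = b′ - b
        Kd : K d
        Kd = K.closed-+ Ka (K.closed-neg Ka′)
        Ke : K e
        Ke = K.closed-+ Kb′ (K.closed-neg Kb)
        d≉0 : ¬ d ≈ 0#
        d≉0 d≈0 = a≉a′ (x∙y⁻¹≈ε⇒x≈y a a′ d≈0)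
        θd≈e : θ * d ≈ e
        θd≈e = +-cancelʳ (θ * a′ + b) (θ * d) e (begin
          θ * d + (θ * a′ + b)     ≈⟨ +-assoc (θ * d) (θ * a′) b ⟨
          (θ * d + θ * a′) + b     ≈⟨ +-congʳ (distribˡ θ d a′) ⟨
          θ * (d + a′) + b         ≈⟨ +-congʳ (*-congˡ (//-rightDividesˡ a′ a)) ⟩
          θ * a + b                ≈⟨ eq ⟩
          θ * a′ + b′              ≈⟨ +-congˡ (//-rightDividesˡ b b′) ⟨
          θ * a′ + (e + b)         ≈⟨ x∙yz≈y∙xz (θ * a′) e b ⟩
          e + (θ * a′ + b)         ∎)

      linear-factors⇒symmetric : ∀ {α β γ δ} → K α → K β → K γ → K δ →
                                 (θ + α) * (θ + β) ≈ (θ + γ) * (θ + δ) →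
                                 α + β ≈ γ + δ × α * β ≈ γ * δ
      linear-factors⇒symmetric {α} {β} {γ} {δ} Kα Kβ Kγ Kδ eq = sums , products
        where
        linear : θ * (α + β) + α * β ≈ θ * (γ + δ) + γ * δ
        linear = +-cancelˡ (θ * θ) _ _ (begin
          θ * θ + (θ * (α + β) + α * β)   ≈⟨ linear-factors-expansion θ α β ⟨
          (θ + α) * (θ + β)               ≈⟨ eq ⟩
          (θ + γ) * (θ + δ)               ≈⟨ linear-factors-expansion θ γ δ ⟩
          θ * θ + (θ * (γ + δ) + γ * δ)   ∎)
        sums : α + β ≈ γ + δ
        sums = K-linear-independence (K.closed-+ Kα Kβ) (K.closed-* Kα Kβ)
                                     (K.closed-+ Kγ Kδ) (K.closed-* Kγ Kδ) linear
        products : α * β ≈ γ * δ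
        products = +-cancelˡ (θ * (γ + δ)) _ _ (trans (+-congʳ (*-congˡ (sym sums))) linear)

module Generator {n : ℕ} (F : CommutativeRing 0ℓ 0ℓ) (fin : IsFiniteFieldOfSize F (suc n))
                 {θ : CommutativeRing.Carrier F} (gen : IsGenerator F θ) where
  open CommutativeRing F
  open IsFiniteFieldOfSize fin
  open FiniteField F fin
  open Powers F
  open import Algebra.Properties.Ring ring using (//-rightDividesˡ)
  open import Relation.Binary.Reasoning.Setoid setoid

  infix 8 θ^_
  θ^_ : ℕ → Carrier
  θ^ a = pow F θ a

  exponent : ∀ x → ¬ x ≈ 0# → ℕ
  exponent x x≉0 = proj₁ (proj₂ gen x x≉0)

  ≈θ^exponent : ∀ x (x≉0 : ¬ x ≈ 0#) → x ≈ θ^ exponent x x≉0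
  ≈θ^exponent x x≉0 = proj₂ (proj₂ gen x x≉0)

  θ^-nonzero : ∀ a → ¬ θ^ a ≈ 0#
  θ^-nonzero zero    = nontrivial
  θ^-nonzero (suc a) = nonzero-* (proj₁ gen) (θ^-nonzero a)

  θ^-difference : ∀ {a b} → a ≤ b → θ^ a ≈ θ^ b → θ^ (b ∸ a) ≈ 1#
  θ^-difference {a} {b} a≤b θ^a≈θ^b = *-cancelˡ-nonzero (θ^-nonzero a) (begin
    θ^ a * θ^ (b ∸ a)     ≈⟨ pow-+ θ a (b ∸ a) ⟨
    θ^ (a ℕ.+ (b ∸ a))    ≡⟨ ≡.cong θ^_ (ℕ.m+[n∸m]≡n a≤b) ⟩
    θ^ b                  ≈⟨ θ^a≈θ^b ⟨
    θ^ a                  ≈⟨ *-identityʳ (θ^ a) ⟨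
    θ^ a * 1#             ∎)

  -- If θ^d = 1, every element is 0 or θ^r with r < d, so the field has at most d + 1 elements.
  period-bound : ∀ {d} → 0 < d → θ^ d ≈ 1# → n ≤ d
  period-bound {suc d} _ θ^d≈1 =
    ℕ.≤-pred (Fin.injective⇒≤ {f = λ i → code (enum i)} (λ eq → enum-inj _ _ (code-injective eq)))
    where
    code : Carrier → Fin (suc (suc d))
    code x with x ≟ 0#
    ... | yes _   = 0F
    ... | no  x≉0 = Fin.suc (fromℕ< (m%n<n (exponent x x≉0) (suc d)))
    code-injective : ∀ {x y} → code x ≡ code y → x ≈ y
    code-injective {x} {y} eq with x ≟ 0# | y ≟ 0#
    ... | yes x≈0 | yes y≈0 = trans x≈0 (sym y≈0)
    ... | no  x≉0 | no  y≉0 = begin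
      x                   ≈⟨ ≈θ^exponent x x≉0 ⟩
      θ^ e                ≈⟨ pow-% θ^d≈1 e ⟩
      θ^ (e % suc d)      ≡⟨ ≡.cong θ^_ residues ⟩
      θ^ (e′ % suc d)     ≈⟨ pow-% θ^d≈1 e′ ⟨
      θ^ e′               ≈⟨ ≈θ^exponent y y≉0 ⟨
      y                   ∎
      where
      e  = exponent x x≉0
      e′ = exponent y y≉0
      residues : e % suc d ≡ e′ % suc d
      residues = ≡.trans (≡.sym (Fin.toℕ-fromℕ< (m%n<n e (suc d))))
                   (≡.trans (≡.cong toℕ (Fin.suc-injective eq)) (Fin.toℕ-fromℕ< (m%n<n e′ (suc d))))

  index-0≢index-θ^ : ∀ a → index 0# ≢ index (θ^ a)
  index-0≢index-θ^ a eq = θ^-nonzero a (sym (index-injective eq))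

  -- Pigeonhole: θ^0, …, θ^n are n + 1 values in the n nonzero elements.
  period-exists : ∃ λ d → 0 < d × d ≤ n × θ^ d ≈ 1#
  period-exists with Fin.pigeonhole (ℕ.n<1+n n) (λ r → punchOut (index-0≢index-θ^ (toℕ r)))
  ... | r , r′ , r<r′ , eq =
    toℕ r′ ∸ toℕ r , ℕ.m<n⇒0<n∸m r<r′ ,
    ℕ.≤-trans (ℕ.m∸n≤m (toℕ r′) (toℕ r)) (ℕ.≤-pred (Fin.toℕ<n r′)) ,
    θ^-difference (ℕ.<⇒≤ r<r′)
      (index-injective (Fin.punchOut-injective (index-0≢index-θ^ (toℕ r)) (index-0≢index-θ^ (toℕ r′)) eq))

  θ^-order : θ^ n ≈ 1#
  θ^-order with period-exists
  ... | d , 0<d , d≤n , θ^d≈1 =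
    ≡.subst (λ m → θ^ m ≈ 1#) (ℕ.≤-antisym d≤n (period-bound 0<d θ^d≈1)) θ^d≈1

  θ^-mod : .{{_ : NonZero n}} → ∀ a → θ^ a ≈ θ^ (a % n)
  θ^-mod = pow-% θ^-order

  distinct-powers : ∀ {a b} → a < b → b < n → ¬ θ^ a ≈ θ^ b
  distinct-powers {a} {b} a<b b<n θ^a≈θ^b = ℕ.<⇒≱ (ℕ.≤-<-trans (ℕ.m∸n≤m b a) b<n)
    (period-bound (ℕ.m<n⇒0<n∸m a<b) (θ^-difference (ℕ.<⇒≤ a<b) θ^a≈θ^b))

  θ^-injective : ∀ {a b} → a < n → b < n → θ^ a ≈ θ^ b → a ≡ b
  θ^-injective {a} {b} a<n b<n θ^a≈θ^b with ℕ.<-cmp a b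
  ... | tri< a<b _ _ = contradiction θ^a≈θ^b (distinct-powers a<b b<n)
  ... | tri≈ _ a≡b _ = a≡b
  ... | tri> _ _ b<a = contradiction (sym θ^a≈θ^b) (distinct-powers b<a a<n)

  generator∉subfield : ∀ {K m} → IsSubfieldOfSize F K m → m ≤ n → ¬ K θ
  generator∉subfield {K} {m} sub m≤n Kθ =
    ℕ.<⇒≱ (s≤s m≤n) (Fin.injective⇒≤ {f = λ i → K-index (enum i)} (λ eq → enum-inj _ _ (K-index-injective eq)))
    where
    module K = IsSubfieldOfSize sub
    powers∈K : ∀ a → K (θ^ a)
    powers∈K zero    = K.has-1
    powers∈K (suc a) = K.closed-* Kθ (powers∈K a)
    everything∈K : ∀ x → K x
    everything∈K x with x ≟ 0#
    ... | yes x≈0 = K.resp (sym x≈0) K.has-0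
    ... | no  x≉0 = K.resp (sym (≈θ^exponent x x≉0)) (powers∈K (exponent x x≉0))
    K-index : Carrier → Fin m
    K-index x = proj₁ (K.enum-surj x (everything∈K x))
    K-index-injective : ∀ {x y} → K-index x ≡ K-index y → x ≈ y
    K-index-injective {x} {y} eq = trans (sym (proj₂ (K.enum-surj x (everything∈K x))))
      (trans (reflexive (≡.cong K.enum eq)) (proj₂ (K.enum-surj y (everything∈K y))))

  translate-injective : ∀ {a b} → a < n → b < n → θ^ a - θ ≈ θ^ b - θ → a ≡ b
  translate-injective {a} {b} a<n b<n eq = θ^-injective a<n b<n (begin
    θ^ a                 ≈⟨ //-rightDividesˡ θ (θ^ a) ⟨
    (θ^ a - θ) + θ       ≈⟨ +-congʳ eq ⟩
    (θ^ b - θ) + θ       ≈⟨ //-rightDividesˡ θ (θ^ b) ⟩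
    θ^ b                 ∎)

  translates-Sidon : ∀ {K m} → IsSubfieldOfSize F K m → m ≤ n → .{{_ : NonZero n}} →
                     Modulo.IsSidon n (λ a → a < n × K (θ^ a - θ))
  translates-Sidon {K} sub m≤n {a} {b} {c} {d} (a<n , Ka) (b<n , Kb) (c<n , Kc) (d<n , Kd) a+b≡c+d
    with uncurry symmetric⇒pair (linear-factors⇒symmetric sub (generator∉subfield sub m≤n) Ka Kb Kc Kd factors)
    where
    θ+translate : ∀ x → θ + (θ^ x - θ) ≈ θ^ x
    θ+translate x = trans (+-comm θ _) (//-rightDividesˡ θ (θ^ x))
    factors : (θ + (θ^ a - θ)) * (θ + (θ^ b - θ)) ≈ (θ + (θ^ c - θ)) * (θ + (θ^ d - θ))
    factors = begin
      (θ + (θ^ a - θ)) * (θ + (θ^ b - θ))   ≈⟨ *-cong (θ+translate a) (θ+translate b) ⟩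
      θ^ a * θ^ b                           ≈⟨ pow-+ θ a b ⟨
      θ^ (a ℕ.+ b)                          ≈⟨ θ^-mod (a ℕ.+ b) ⟩
      θ^ ((a ℕ.+ b) % n)                    ≡⟨ ≡.cong θ^_ a+b≡c+d ⟩
      θ^ ((c ℕ.+ d) % n)                    ≈⟨ θ^-mod (c ℕ.+ d) ⟨
      θ^ (c ℕ.+ d)                          ≈⟨ pow-+ θ c d ⟩
      θ^ c * θ^ d                           ≈⟨ *-cong (θ+translate c) (θ+translate d) ⟨
      (θ + (θ^ c - θ)) * (θ + (θ^ d - θ))   ∎
  ... | inj₁ (a≈c , b≈d) = inj₁ (translate-injective a<n c<n a≈c , translate-injective b<n d<n b≈d)
  ... | inj₂ (a≈d , b≈c) = inj₂ (translate-injective a<n d<n a≈d , translate-injective b<n c<n b≈c)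

-- The graph Γ_{q,t}

open import Data.Nat using (_+_; _*_)
open ≡ using (refl; sym; trans; cong; subst)

Bool×Fin↣Fin : ∀ {k} → (Bool × Fin k) ↣ Fin (2 * k)
Bool×Fin↣Fin = ↔⇒↣ (↔-trans (↔-sym Fin.2↔Bool ×-↔ ↔-refl) (↔-sym Fin.*↔×))

module CosetGraph (q t : ℕ) .{{_ : NonZero t}} .{{_ : NonZero (q ^ 2 ∸ 1)}} (A : ℕ → Set)
  (t*g≡n : t * ((q ∸ 1) / t * (q + 1)) ≡ q ^ 2 ∸ 1)
  (sidon : Modulo.IsSidon (q ^ 2 ∸ 1) A) where

  open CommutativeSemigroupProperties ℕ.+-commutativeSemigroup using (xy∙z≈xz∙y; x∙yz≈yx∙z)
  open Gamma q t A
  open Modulo n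

  ≡ₘ⇒∼H : ∀ {x y} → x ≡ₘ y → x ∼H y
  ≡ₘ⇒∼H {x} x≡y = 0 , trans (cong (_% n) (ℕ.+-identityʳ x)) x≡y

  ∼H-sym : ∀ {x y} → x ∼H y → y ∼H x
  ∼H-sym {x} {y} (k , x+kg≡y) = (t ∸ 1) * k , (begin
    y + (t ∸ 1) * k * g          ≈⟨ +-cong-≡ₘ {y} (sym x+kg≡y) refl ⟩
    x + k * g + (t ∸ 1) * k * g  ≡⟨ collect x k g (t ∸ 1) ⟩
    x + k * (suc (t ∸ 1) * g)    ≡⟨ cong (λ s → x + k * (s * g)) (ℕ.suc-pred t) ⟩
    x + k * (t * g)              ≡⟨ cong (λ m → x + k * m) t*g≡n ⟩
    x + k * n                    ≈⟨ +-multiple-≡ₘ x k ⟩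
    x                            ∎)
    where
    open import Relation.Binary.Reasoning.Setoid ≡ₘ-setoid
    collect : ∀ x k g u → x + k * g + u * k * g ≡ x + k * (suc u * g)
    collect = solve-∀

  ∼H-trans : ∀ {x y z} → x ∼H y → y ∼H z → x ∼H z
  ∼H-trans {x} {y} {z} (k , x+kg≡y) (l , y+lg≡z) = k + l , (begin
    x + (k + l) * g              ≡⟨ distribute x k l g ⟩
    x + k * g + l * g            ≈⟨ +-cong-≡ₘ {x + k * g} x+kg≡y refl ⟩
    y + l * g                    ≈⟨ y+lg≡z ⟩
    z                            ∎)
    where
    open import Relation.Binary.Reasoning.Setoid ≡ₘ-setoid
    distribute : ∀ x k l g → x + (k + l) * g ≡ x + k * g + l * g
    distribute = solve-∀

  ∼H-+ʳ : ∀ {x y} c → x ∼H y → (x + c) ∼H (y + c)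
  ∼H-+ʳ {x} c (k , x+kg≡y) = k , trans (cong (_% n) (xy∙z≈xz∙y x c (k * g))) (+-cong-≡ₘ {x + k * g} x+kg≡y refl)

  ∼H-cancelʳ : ∀ {x y} c → (x + c) ∼H (y + c) → x ∼H y
  ∼H-cancelʳ {x} {y} c (k , eq) = k , +-cancelʳ-≡ₘ (x + k * g) y c (trans (cong (_% n) (xy∙z≈xz∙y x (k * g) c)) eq)

  ∼H-normal : ∀ {x y} → x ∼H y → ∃ λ (ρ : Fin t) → x + toℕ ρ * g ≡ₘ y
  ∼H-normal {x} {y} (k , x+kg≡y) = fromℕ< (m%n<n k t) , (begin
    x + toℕ (fromℕ< (m%n<n k t)) * g   ≡⟨ cong (λ r → x + r * g) (Fin.toℕ-fromℕ< (m%n<n k t)) ⟩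
    x + k % t * g                      ≈⟨ +-multiple-≡ₘ (x + k % t * g) (k / t) ⟨
    x + k % t * g + k / t * n          ≡⟨ cong (λ m → x + k % t * g + k / t * m) t*g≡n ⟨
    x + k % t * g + k / t * (t * g)    ≡⟨ collect x (k % t) (k / t) t g ⟩
    x + (k % t + k / t * t) * g        ≡⟨ cong (λ m → x + m * g) (m≡m%n+[m/n]*n k t) ⟨
    x + k * g                          ≈⟨ x+kg≡y ⟩
    y                                  ∎)
    where
    open import Relation.Binary.Reasoning.Setoid ≡ₘ-setoid
    collect : ∀ x r d t g → x + r * g + d * (t * g) ≡ x + (r + d * t) * g
    collect = solve-∀

  next³≡id : ∀ i → next (next (next i)) ≡ i
  next³≡id 0F = refl
  next³≡id 1F = refl
  next³≡id 2F = refl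

  next-injective : ∀ {i j} → next i ≡ next j → i ≡ j
  next-injective {i} {j} eq = trans (sym (next³≡id i)) (trans (cong (λ k → next (next k)) eq) (next³≡id j))

  next-irreflexive : ∀ i → next i ≢ i
  next-irreflexive 0F ()
  next-irreflexive 1F ()
  next-irreflexive 2F ()

  next²-irreflexive : ∀ i → next (next i) ≢ i
  next²-irreflexive 0F ()
  next²-irreflexive 1F ()
  next²-irreflexive 2F ()

  parts-trichotomy : ∀ i j → i ≡ j ⊎ j ≡ next i ⊎ i ≡ next j
  parts-trichotomy 0F 0F = inj₁ refl
  parts-trichotomy 0F 1F = inj₂ (inj₁ refl)
  parts-trichotomy 0F 2F = inj₂ (inj₂ refl)
  parts-trichotomy 1F 0F = inj₂ (inj₂ refl)
  parts-trichotomy 1F 1F = inj₁ refl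
  parts-trichotomy 1F 2F = inj₂ (inj₁ refl)
  parts-trichotomy 2F 0F = inj₂ (inj₁ refl)
  parts-trichotomy 2F 1F = inj₂ (inj₂ refl)
  parts-trichotomy 2F 2F = inj₁ refl

  infix 4 _─[_]→_
  data _─[_]→_ : Vertex → ℕ → Vertex → Set where
    step : ∀ {i x j y a} → j ≡ next i → (x + a) ∼H y → (i , x) ─[ a ]→ (j , y)

  step-functional : ∀ {u v v′ a} → u ─[ a ]→ v → u ─[ a ]→ v′ → v ≋ v′
  step-functional (step j≡ x+a∼y) (step j′≡ x+a∼y′) =
    trans j≡ (sym j′≡) , ∼H-trans (∼H-sym x+a∼y) x+a∼y′

  step-injective : ∀ {u v v′ a} → v ─[ a ]→ u → v′ ─[ a ]→ u → v ≋ v′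
  step-injective {a = a} (step i≡ y+a∼x) (step i≡′ y′+a∼x) =
    next-injective (trans (sym i≡) i≡′) , ∼H-cancelʳ a (∼H-trans y+a∼x (∼H-sym y′+a∼x))

  record Labelling (u₁ u₂ : Vertex) (C : Set) : Set₁ where
    field
      Label            : Vertex → C → Set
      label            : ∀ {v} → Adj u₁ v → Adj u₂ v → ∃ (Label v)
      label-determines : ∀ {v v′ c} → Label v c → Label v′ c → v ≋ v′

  swap : ∀ {u₁ u₂ C} → Labelling u₁ u₂ C → Labelling u₂ u₁ C
  swap L = record
    { Label            = Label
    ; label            = λ adj₂ adj₁ → label adj₁ adj₂
    ; label-determines = label-determines
    }
    where open Labelling L

  labelling⇒≤ : ∀ {u₁ u₂ C k m} → Labelling u₁ u₂ C → C ↣ Fin k →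
                (w : Fin m → Vertex) → (∀ r r′ → w r ≋ w r′ → r ≡ r′) →
                (∀ r → Adj u₁ (w r) × Adj u₂ (w r)) → m ≤ k
  labelling⇒≤ L code w w-injective adjacent =
    Fin.injective⇒≤ {f = λ r → to (proj₁ (labelled r))} λ {r} {r′} eq →
      w-injective r r′ (label-determines (proj₂ (labelled r))
        (subst (Label (w r′)) (sym (injective eq)) (proj₂ (labelled r′))))
    where
    open Labelling L
    open Injection code
    labelled : ∀ r → ∃ (Label (w r))
    labelled r = label (proj₁ (adjacent r)) (proj₂ (adjacent r))

  data SamePartLabel (i : Fin 3) (x y : ℕ) (v : Vertex) : Bool × Fin t → Set where
    outward : ∀ {a b ρ} → A a → A b → (i , x) ─[ a ]→ v →
              x + a + toℕ ρ * g ≡ₘ y + b → SamePartLabel i x y v (true , ρ)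
    inward  : ∀ {a b ρ} → A a → A b → v ─[ a ]→ (i , x) →
              y + a + toℕ ρ * g ≡ₘ x + b → SamePartLabel i x y v (false , ρ)

  same-part-labelling : ∀ {i x y} → ¬ x ∼H y → Labelling (i , x) (i , y) (Bool × Fin t)
  same-part-labelling {i} {x} {y} x≁y = record
    { Label = SamePartLabel i x y ; label = label ; label-determines = determines }
    where
    label : ∀ {v} → Adj (i , x) v → Adj (i , y) v → ∃ (SamePartLabel i x y v)
    label {k , z} (inj₁ (k≡ , a , Aa , x+a∼z)) (inj₁ (_ , b , Ab , y+b∼z))
      with ∼H-normal (∼H-trans x+a∼z (∼H-sym y+b∼z))
    ... | ρ , eq = (true , ρ) , outward Aa Ab (step k≡ x+a∼z) eq
    label {k , z} (inj₂ (i≡ , a , Aa , z+a∼x)) (inj₂ (_ , b , Ab , z+b∼y))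
      with ∼H-normal (∼H-trans (∼H-+ʳ a (∼H-sym z+b∼y))
                       (∼H-trans (≡ₘ⇒∼H (cong (_% n) (xy∙z≈xz∙y z b a))) (∼H-+ʳ b z+a∼x)))
    ... | ρ , eq = (false , ρ) , inward Aa Ab (step i≡ z+a∼x) eq
    label {k , z} (inj₁ (k≡ , _)) (inj₂ (i≡ , _)) =
      ⊥-elim (next²-irreflexive i (sym (trans i≡ (cong next k≡))))
    label {k , z} (inj₂ (i≡ , _)) (inj₁ (k≡ , _)) =
      ⊥-elim (next²-irreflexive i (sym (trans i≡ (cong next k≡))))

    determines : ∀ {v v′ c} → SamePartLabel i x y v c → SamePartLabel i x y v′ c → v ≋ v′
    determines (outward {ρ = ρ} Aa Ab st eq) (outward Aa′ Ab′ st′ eq′)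
      with sidon-difference sidon x y (toℕ ρ * g) Aa Ab Aa′ Ab′ eq eq′
    ... | inj₁ refl    = step-functional st st′
    ... | inj₂ x+ρg≡y  = ⊥-elim (x≁y (toℕ ρ , x+ρg≡y))
    determines (inward {ρ = ρ} Aa Ab st eq) (inward Aa′ Ab′ st′ eq′)
      with sidon-difference sidon y x (toℕ ρ * g) Aa Ab Aa′ Ab′ eq eq′
    ... | inj₁ refl    = step-injective st st′
    ... | inj₂ y+ρg≡x  = ⊥-elim (x≁y (∼H-sym (toℕ ρ , y+ρg≡x)))

  data AdjacentPartLabel (j : Fin 3) (x y : ℕ) (v : Vertex) : Bool × Fin t → Set where
    through : ∀ {a b ρ β} → A a → A b → (j , y) ─[ b ]→ v →
              y + (b + a) + toℕ ρ * g ≡ₘ x → (b ≤ᵇ a) ≡ β → AdjacentPartLabel j x y v (β , ρ)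

  adjacent-part-labelling : ∀ {i x y} → Labelling (i , x) (next i , y) (Bool × Fin t)
  adjacent-part-labelling {i} {x} {y} = record
    { Label = AdjacentPartLabel (next i) x y ; label = label ; label-determines = determines }
    where
    label : ∀ {v} → Adj (i , x) v → Adj (next i , y) v → ∃ (AdjacentPartLabel (next i) x y v)
    label {k , z} (inj₂ (_ , a , Aa , z+a∼x)) (inj₁ (k≡ , b , Ab , y+b∼z))
      with ∼H-normal (∼H-trans (≡ₘ⇒∼H (cong (_% n) (sym (ℕ.+-assoc y b a)))) (∼H-trans (∼H-+ʳ a y+b∼z) z+a∼x))
    ... | ρ , eq = ((b ≤ᵇ a) , ρ) , through Aa Ab (step k≡ y+b∼z) eq refl
    label {k , z} (inj₁ (k≡ , _)) (inj₁ (k≡′ , _)) =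
      ⊥-elim (next-irreflexive (next i) (trans (sym k≡′) k≡))
    label {k , z} (inj₁ (k≡ , _)) (inj₂ (j≡ , _)) =
      ⊥-elim (next-irreflexive (next i) (trans (cong next (sym k≡)) (sym j≡)))
    label {k , z} (inj₂ (i≡ , _)) (inj₂ (j≡ , _)) =
      ⊥-elim (next-irreflexive i (trans j≡ (sym i≡)))

    determines : ∀ {v v′ c} → AdjacentPartLabel (next i) x y v c → AdjacentPartLabel (next i) x y v′ c → v ≋ v′
    determines (through {a} {b} {ρ} Aa Ab st eq b≤a) (through {a′} {b′} Aa′ Ab′ st′ eq′ b′≤a′)
      with sidon-ordered-sum sidon Ab Aa Ab′ Aa′ sums (trans b≤a (sym b′≤a′))
      where
      open import Relation.Binary.Reasoning.Setoid ≡ₘ-setoid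
      sums : b + a ≡ₘ b′ + a′
      sums = +-cancelʳ-≡ₘ (b + a) (b′ + a′) (y + toℕ ρ * g) (begin
        (b + a) + (y + toℕ ρ * g)     ≡⟨ x∙yz≈yx∙z (b + a) y (toℕ ρ * g) ⟩
        y + (b + a) + toℕ ρ * g       ≈⟨ eq ⟩
        x                             ≈⟨ eq′ ⟨
        y + (b′ + a′) + toℕ ρ * g     ≡⟨ x∙yz≈yx∙z (b′ + a′) y (toℕ ρ * g) ⟨
        (b′ + a′) + (y + toℕ ρ * g)   ∎)
    ... | refl = step-functional st st′

  common-neighbour-labelling : ∀ {u₁ u₂} → ¬ u₁ ≋ u₂ → Labelling u₁ u₂ (Bool × Fin t)
  common-neighbour-labelling {i , x} {j , y} u₁≉u₂ with parts-trichotomy i j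
  ... | inj₁ refl        = same-part-labelling (λ x∼y → u₁≉u₂ (refl , x∼y))
  ... | inj₂ (inj₁ refl) = adjacent-part-labelling
  ... | inj₂ (inj₂ refl) = swap adjacent-part-labelling

  no-K₂ : ¬ ContainsK2 (2 * t + 1)
  no-K₂ (u₁ , u₂ , w , u₁≉u₂ , _ , w-injective , adjacent) =
    ℕ.1+n≰n (subst (_≤ 2 * t) (ℕ.+-comm (2 * t) 1)
      (labelling⇒≤ (common-neighbour-labelling u₁≉u₂) Bool×Fin↣Fin w w-injective adjacent))

[q∸1][q+1]≡q²∸1 : ∀ q → (q ∸ 1) * (q + 1) ≡ q ^ 2 ∸ 1
[q∸1][q+1]≡q²∸1 zero    = refl
[q∸1][q+1]≡q²∸1 (suc p) = cong (_∸ 1) (expand p)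
  where
  expand : ∀ p → 1 + p * ((1 + p) + 1) ≡ (1 + p) * ((1 + p) * 1)
  expand = solve-∀

t*g≡q²∸1 : ∀ q t .{{_ : NonZero t}} → t ∣ q ∸ 1 → t * ((q ∸ 1) / t * (q + 1)) ≡ q ^ 2 ∸ 1
t*g≡q²∸1 q t t∣q∸1 = begin
  t * ((q ∸ 1) / t * (q + 1))     ≡⟨ ℕ.*-assoc t ((q ∸ 1) / t) (q + 1) ⟨
  t * ((q ∸ 1) / t) * (q + 1)     ≡⟨ cong (_* (q + 1)) (m*[n/m]≡n t∣q∸1) ⟩
  (q ∸ 1) * (q + 1)               ≡⟨ [q∸1][q+1]≡q²∸1 q ⟩
  q ^ 2 ∸ 1                       ∎
  where open ≡.≡-Reasoning

2+p≤[2+p]²∸1 : ∀ p → 2 + p ≤ (2 + p) ^ 2 ∸ 1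
2+p≤[2+p]²∸1 p = ℕ.<⇒≤pred (subst (2 + p <_) (cong ((2 + p) *_) (sym (ℕ.*-identityʳ (2 + p))))
                                 (ℕ.m<m*n (2 + p) (2 + p) (s≤s (s≤s z≤n))))

lemma3 : (t q : ℕ) .{{_ : NonZero t}} .{{_ : NonZero (q ^ 2 ∸ 1)}} →
         t ≥ 1 → IsPrimePower q → t ∣ (q ∸ 1) →
         (F : CommutativeRing 0ℓ 0ℓ) → IsFiniteFieldOfSize F (q ^ 2) →
         (Fq : CommutativeRing.Carrier F → Set) → IsSubfieldOfSize F Fq q →
         (θ : CommutativeRing.Carrier F) → IsGenerator F θ →
         ¬ Gamma.ContainsK2 q t (InA F Fq q θ) (2 * t + 1)
lemma3 t zero          _ _ _ _ _ _ _ _ _ = ⊥-elim (ℕ.≢-nonZero⁻¹ 0 refl)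
lemma3 t (suc zero)    _ _ _ _ _ _ _ _ _ = ⊥-elim (ℕ.≢-nonZero⁻¹ 0 refl)
lemma3 t q@(suc (suc p)) _ _ t∣q∸1 F fin Fq sub θ gen =
  CosetGraph.no-K₂ q t (InA F Fq q θ) (t*g≡q²∸1 q t t∣q∸1)
    (Generator.translates-Sidon {n = q ^ 2 ∸ 1} F fin gen sub (2+p≤[2+p]²∸1 p))
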